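{- For every in-fact-strong $\bullet$gtf-model $M=\langle W,\mu,\mathcal{F},V\rangle$ there exists a strong generalized topological model $M'=\langle W,\tau,V\rangle$ (same worlds, same valuation) which is pointwise equivalent to $M$: for every $w\in W$ and every formula $\varphi$, $w\Vdash\varphi$ in $M$ (the modality read as $\bullet$) iff $w\Vdash\varphi$ in $M'$ (the modality read as $\Box$).
   Context: Formulas are built from a countable set $PV$ of propositional variables using $\bot,\lnot,\land,\lor,\to$ and one unary modality. A generalized topology on a nonempty set $W$ is a family $\mu\subseteq P(W)$ with $\emptyset\in\mu$ and closed under unions of arbitrary nonempty subfamilies; $\bigcup\mu$ is the union of its members; it is strong if $W\in\mu$. A $\bullet$gtf-model is $\langle W,\mu,\mathcal{F},V\rangle$ where $\mu$ is a generalized topology on $W$, $V:PV\to P(W)$, and $\mathcal{F}:W\to P(P(\bigcup\mu))$ satisfies: if $w\in\bigcup\mu$ then $X\in\mathcal{F}_w$ iff ($X\in\mu$ and $w\in X$); if $w\notin\bigcup\mu$ then $\mathcal{F}_w\subseteq\mu$. For $A\in\mu$ put $A^{ -1}=\{z\in W:A\in\mathcal{F}_z\}$. Satisfaction: Boolean clauses classical, $w\Vdash q$ iff $w\in V(q)$, and $w\Vdash\bullet\varphi$ iff there is $O\in\mathcal{F}_w$ with $v\Vdash\varphi$ for all $v\in O^{ -1}$. It is in-fact-strong if for every $w\in W\setminus\bigcup\mu$: (i) if $X\in\mathcal{F}_w$ and $X\subseteq Y\in\mu$ then $Y\in\mathcal{F}_w$; (ii) if $(X_i)_{i\in J}$ is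 a family of members of $\mu$ with $\bigcup_{i\in J}X_i\in\mathcal{F}_w$, then there is $k\in J$ with $w\in X_k^{ -1}$; (iii) $\mathcal{F}_w\neq\emptyset$. A strong generalized topological model is $\langle W,\tau,V\rangle$ with $\tau$ a strong generalized topology on $W$ and $V:PV\to P(W)$; satisfaction: Boolean clauses classical and $w\Vdash\Box\varphi$ iff there is $X\in\tau$ with $w\in X$ and $v\Vdash\varphi$ for all $v\in X$. -}

module Defs where

open import Level using (Level; 0ℓ) renaming (suc to lsuc)
open import Data.Nat using (ℕ)
open import Data.Empty using (⊥)
open import Data.Unit using (⊤)
open import Data.Product using (Σ; _×_; _,_)
open import Data.Sum using (_⊎_)
open import Relation.Nullary using (¬_)

PV : Set
PV = ℕ

-- Formulas with one unary modality `◆` (read as • in gtf-models, □ in gt-models).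
data Form : Set where
  var  : PV → Form
  ⊥'   : Form
  ¬'_  : Form → Form
  _∧'_ : Form → Form → Form
  _∨'_ : Form → Form → Form
  _⇒'_ : Form → Form → Form
  ◆_   : Form → Form

Subset : Set → Set₁
Subset W = W → Set

Family : Set → Set₂
Family W = Subset W → Set₁

_⊆_ : {W : Set} → Subset W → Subset W → Set
A ⊆ B = ∀ w → A w → B w

∅ : {W : Set} → Subset W
∅ _ = ⊥

Full : {W : Set} → Subset W
Full _ = ⊤

⋃ᵢ : {W : Set} (J : Set) → (J → Subset W) → Subset W
⋃ᵢ J X w = Σ J λ i → X i w

⋃F : {W : Set} → Family W → W → Set₁
⋃F μ w = Σ (Subset _) λ X → μ X × X w

-- Generalized topology: contains ∅, closed under unions of arbitrary
-- nonempty subfamilies (given as indexed families with an inhabited index set).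
record IsGenTop (W : Set) (μ : Family W) : Set₂ where
  field
    empty∈  : μ ∅
    unions∈ : (J : Set) → J → (X : J → Subset W) →
              (∀ i → μ (X i)) → μ (⋃ᵢ J X)

record IsStrongGenTop (W : Set) (τ : Family W) : Set₂ where
  field
    isGenTop : IsGenTop W τ
    full∈    : τ Full

record GTFModel (W : Set) : Set₂ where
  field
    point  : W
    μ      : Family W
    isGT   : IsGenTop W μ
    𝓕      : W → Family W
    V      : PV → Subset W
    𝓕⊆P⋃μ  : ∀ w X → 𝓕 w X → ∀ v → X v → ⋃F μ v
    in⋃→   : ∀ w → ⋃F μ w → ∀ X → 𝓕 w X → μ X × X w
    in⋃←   : ∀ w → ⋃F μ w → ∀ X → μ X × X w → 𝓕 w X
    out⋃   : ∀ w → ¬ ⋃F μ w → ∀ X → 𝓕 w X → μ X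

  _⁻¹ : Subset W → W → Set₁
  (A ⁻¹) z = 𝓕 z A

record InFactStrong {W : Set} (M : GTFModel W) : Set₂ where
  open GTFModel M
  field
    upward   : ∀ w → ¬ ⋃F μ w → ∀ X Y → 𝓕 w X → X ⊆ Y → μ Y → 𝓕 w Y
    split    : ∀ w → ¬ ⋃F μ w → (J : Set) (X : J → Subset W) →
               (∀ i → μ (X i)) → 𝓕 w (⋃ᵢ J X) → Σ J λ k → (X k ⁻¹) w
    nonempty : ∀ w → ¬ ⋃F μ w → Σ (Subset W) λ X → 𝓕 w X

_,_⊩•_ : {W : Set} → GTFModel W → W → Form → Set₁
M , w ⊩• var q    = Level.Lift _ (GTFModel.V M q w)
M , w ⊩• ⊥'       = Level.Lift _ ⊥
M , w ⊩• (¬' φ)   = ¬ (M , w ⊩• φ)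
M , w ⊩• (φ ∧' ψ) = (M , w ⊩• φ) × (M , w ⊩• ψ)
M , w ⊩• (φ ∨' ψ) = (M , w ⊩• φ) ⊎ (M , w ⊩• ψ)
M , w ⊩• (φ ⇒' ψ) = (M , w ⊩• φ) → (M , w ⊩• ψ)
M , w ⊩• (◆ φ)    = Σ (Subset _) λ O → GTFModel.𝓕 M w O ×
                      (∀ v → GTFModel._⁻¹ M O v → M , v ⊩• φ)

record SGTModel (W : Set) : Set₂ where
  field
    point    : W
    τ        : Family W
    isStrong : IsStrongGenTop W τ
    V        : PV → Subset W

_,_⊩□_ : {W : Set} → SGTModel W → W → Form → Set₁
M , w ⊩□ var q    = Level.Lift _ (SGTModel.V M q w)
M , w ⊩□ ⊥'       = Level.Lift _ ⊥
M , w ⊩□ (¬' φ)   = ¬ (M , w ⊩□ φ)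
M , w ⊩□ (φ ∧' ψ) = (M , w ⊩□ φ) × (M , w ⊩□ ψ)
M , w ⊩□ (φ ∨' ψ) = (M , w ⊩□ φ) ⊎ (M , w ⊩□ ψ)
M , w ⊩□ (φ ⇒' ψ) = (M , w ⊩□ φ) → (M , w ⊩□ ψ)
M , w ⊩□ (◆ φ)    = Σ (Subset _) λ X → SGTModel.τ M X × X w ×
                      (∀ v → X v → M , v ⊩□ φ)

-- Let τ consist of the sets X in which every point w has some O ∈ 𝓕_w with
-- O⁻¹ ⊆ X.  This family is closed under unions, and every O⁻¹ belongs to it
-- (z ∈ O⁻¹ means O ∈ 𝓕_z), so "some O ∈ 𝓕_w has φ on O⁻¹" and "some τ-open
-- X ∋ w has φ on X" say the same thing; induction on φ finishes.  τ contains
-- W as soon as every 𝓕_w is nonempty, which is all that is used of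
-- in-fact-strongness (condition (iii), plus 𝓕_w ∋ X for w ∈ X ∈ μ).
module Submission where

open import Defs
open import Level using (0ℓ) renaming (suc to lsuc)
open import Axiom.ExcludedMiddle using (ExcludedMiddle)
open import Data.Product using (Σ; _×_; _,_)
open import Data.Sum using (inj₁; inj₂)
open import Data.Unit using (tt)
open import Relation.Nullary using (yes; no)
open import Relation.Nullary.Decidable using (True; toWitness; fromWitness)
open import Relation.Binary.PropositionalEquality using (_≡_; refl)

module NeighbourhoodTopology {W : Set} (𝓕 : W → Family W) where

  τ : Family W
  τ X = ∀ w → X w → Σ (Subset W) λ O → 𝓕 w O × (∀ v → 𝓕 v O → X v)

  τ-isGenTop : IsGenTop W τ
  τ-isGenTop = record
    { empty∈  = λ _ ()
    ; unions∈ = λ J _ X X∈τ → λ { w (i , w∈Xi) →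
        let (O , O∈𝓕w , O⁻¹⊆Xi) = X∈τ i w w∈Xi
        in  O , O∈𝓕w , λ v O∈𝓕v → i , O⁻¹⊆Xi v O∈𝓕v }
    }

  τ-isStrong : (∀ w → Σ (Subset W) (𝓕 w)) → IsStrongGenTop W τ
  τ-isStrong 𝓕-nonempty = record
    { isGenTop = τ-isGenTop
    ; full∈    = λ w _ → let (O , O∈𝓕w) = 𝓕-nonempty w in O , O∈𝓕w , λ _ _ → tt
    }

𝓕-nonempty : ExcludedMiddle (lsuc 0ℓ) → {W : Set} (M : GTFModel W) → InFactStrong M →
             ∀ w → Σ (Subset W) (GTFModel.𝓕 M w)
𝓕-nonempty em M ifs w with em {⋃F (GTFModel.μ M) w}
... | yes w∈⋃μ@(X , X∈μ , w∈X) = X , GTFModel.in⋃← M w w∈⋃μ X (X∈μ , w∈X)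
... | no  w∉⋃μ                  = InFactStrong.nonempty ifs w w∉⋃μ

module Topologize (em : ExcludedMiddle (lsuc 0ℓ)) {W : Set} (M : GTFModel W)
                  (𝓕-nonempty : ∀ w → Σ (Subset W) (GTFModel.𝓕 M w)) where
  open GTFModel M
  open NeighbourhoodTopology 𝓕

  M′ : SGTModel W
  M′ = record { point = point ; τ = τ ; isStrong = τ-isStrong 𝓕-nonempty ; V = V }

  -- O⁻¹ is a family of Set₁-propositions; excluded middle shrinks it to a Subset.
  ⌊_⁻¹⌋ : Subset W → Subset W
  ⌊ O ⁻¹⌋ v = True (em {(O ⁻¹) v})

  ⌊⁻¹⌋∈τ : ∀ O → τ ⌊ O ⁻¹⌋
  ⌊⁻¹⌋∈τ O w w∈O⁻¹ = O , toWitness w∈O⁻¹ , λ _ O∈𝓕v → fromWitness O∈𝓕v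

  mutual
    ⊩•⇒⊩□ : ∀ w φ → M , w ⊩• φ → M′ , w ⊩□ φ
    ⊩•⇒⊩□ w (var q)  p             = p
    ⊩•⇒⊩□ w ⊥'       p             = p
    ⊩•⇒⊩□ w (¬' φ)   ¬p            = λ p → ¬p (⊩□⇒⊩• w φ p)
    ⊩•⇒⊩□ w (φ ∧' ψ) (p , q)       = ⊩•⇒⊩□ w φ p , ⊩•⇒⊩□ w ψ q
    ⊩•⇒⊩□ w (φ ∨' ψ) (inj₁ p)      = inj₁ (⊩•⇒⊩□ w φ p)
    ⊩•⇒⊩□ w (φ ∨' ψ) (inj₂ q)      = inj₂ (⊩•⇒⊩□ w ψ q)
    ⊩•⇒⊩□ w (φ ⇒' ψ) f             = λ p → ⊩•⇒⊩□ w ψ (f (⊩□⇒⊩• w φ p))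
    ⊩•⇒⊩□ w (◆ φ)    (O , O∈𝓕w , φ-on-O⁻¹) =
      ⌊ O ⁻¹⌋ , ⌊⁻¹⌋∈τ O , fromWitness O∈𝓕w , λ v v∈O⁻¹ → ⊩•⇒⊩□ v φ (φ-on-O⁻¹ v (toWitness v∈O⁻¹))

    ⊩□⇒⊩• : ∀ w φ → M′ , w ⊩□ φ → M , w ⊩• φ
    ⊩□⇒⊩• w (var q)  p             = p
    ⊩□⇒⊩• w ⊥'       p             = p
    ⊩□⇒⊩• w (¬' φ)   ¬p            = λ p → ¬p (⊩•⇒⊩□ w φ p)
    ⊩□⇒⊩• w (φ ∧' ψ) (p , q)       = ⊩□⇒⊩• w φ p , ⊩□⇒⊩• w ψ q
    ⊩□⇒⊩• w (φ ∨' ψ) (inj₁ p)      = inj₁ (⊩□⇒⊩• w φ p)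
    ⊩□⇒⊩• w (φ ∨' ψ) (inj₂ q)      = inj₂ (⊩□⇒⊩• w ψ q)
    ⊩□⇒⊩• w (φ ⇒' ψ) f             = λ p → ⊩□⇒⊩• w ψ (f (⊩•⇒⊩□ w φ p))
    ⊩□⇒⊩• w (◆ φ)    (X , X∈τ , w∈X , φ-on-X) =
      let (O , O∈𝓕w , O⁻¹⊆X) = X∈τ w w∈X
      in  O , O∈𝓕w , λ v O∈𝓕v → ⊩□⇒⊩• v φ (φ-on-X v (O⁻¹⊆X v O∈𝓕v))

mainTheorem11 : ExcludedMiddle (lsuc 0ℓ) →
    {W : Set} (M : GTFModel W) → InFactStrong M →
    Σ (SGTModel W) λ M' →
      (SGTModel.V M' ≡ GTFModel.V M) ×
      (∀ (w : W) (φ : Form) →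
        ((M , w ⊩• φ) → (M' , w ⊩□ φ)) × ((M' , w ⊩□ φ) → (M , w ⊩• φ)))
mainTheorem11 em M ifs = M′ , refl , λ w φ → ⊩•⇒⊩□ w φ , ⊩□⇒⊩• w φ
  where open Topologize em M (𝓕-nonempty em M ifs)
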